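{- Let $\mathcal{C}$ be the set of all finite fields $\mathbb{F}_p$, $p$ prime, viewed as structures over the language $\{0,1,+\}$ (with the usual interpretations). Then: (i) for every non-empty finite set $X$ of primes, there is a positive existential $\{0,1,+\}$-formula $\varphi(x)$ such that for every $p\in X$ and every $a\in\mathbb{F}_p$, $\mathbb{F}_p\models\varphi(a)$ if and only if $a$ is a square in $\mathbb{F}_p$; (ii) for no infinite set $X$ of primes does there exist a positive existential $\{0,1,+\}$-formula $\varphi(x)$ such that for every $p\in X$, $\varphi$ defines the set of squares of $\mathbb{F}_p$. In particular, there is no positive existential $\{0,1,+\}$-formula $\mu(x,y,w)$ which defines the graph of multiplication $\{(x,y,w)\colon w=xy\}$ in every $\mathbb{F}_p$, $p$ prime. -}

module Defs where

open import Data.Nat using (ℕ; zero; suc; _+_; _*_; _%_; NonZero)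
open import Data.Fin using (Fin; toℕ)
import Data.Fin as F
open import Data.Product using (Σ; _×_)
open import Data.Sum using (_⊎_)
open import Data.Nat.Primality using (Prime; prime⇒nonZero)
open import Function.Bundles using (_⇔_)
open import Relation.Binary.PropositionalEquality using (_≡_)

data Term (n : ℕ) : Set where
  var  : Fin n → Term n
  𝟘    : Term n
  𝟙    : Term n
  _⊕_  : Term n → Term n → Term n

data PEFormula (n : ℕ) : Set where
  _≐_  : Term n → Term n → PEFormula n
  _∧′_ : PEFormula n → PEFormula n → PEFormula n
  _∨′_ : PEFormula n → PEFormula n → PEFormula n
  ∃′   : PEFormula (suc n) → PEFormula n

-- Elements of F_p are represented by Fin p (residues 0,…,p-1).
-- Extend an assignment by a new variable 0 (de Bruijn).
extend : ∀ {n p} → Fin p → (Fin n → Fin p) → Fin (suc n) → Fin p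
extend b ρ F.zero    = b
extend b ρ (F.suc i) = ρ i

-- Value of a term as a natural number; its value in F_p is this mod p.
eval : ∀ {n p} → (Fin n → Fin p) → Term n → ℕ
eval ρ (var i) = toℕ (ρ i)
eval ρ 𝟘       = 0
eval ρ 𝟙       = 1
eval ρ (s ⊕ t) = eval ρ s + eval ρ t

Sat : (p : ℕ) → .{{NonZero p}} → ∀ {n} → (Fin n → Fin p) → PEFormula n → Set
Sat p ρ (s ≐ t)  = eval ρ s % p ≡ eval ρ t % p
Sat p ρ (φ ∧′ ψ) = Sat p ρ φ × Sat p ρ ψ
Sat p ρ (φ ∨′ ψ) = Sat p ρ φ ⊎ Sat p ρ ψ
Sat p ρ (∃′ φ)   = Σ (Fin p) λ b → Sat p (extend b ρ) φ

IsSquare : (p : ℕ) → .{{NonZero p}} → Fin p → Set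
IsSquare p a = Σ (Fin p) λ b → (toℕ b * toℕ b) % p ≡ toℕ a % p

DefinesSquares : (p : ℕ) → Prime p → PEFormula 1 → Set
DefinesSquares p pr φ = ∀ (a : Fin p) → Sat p (λ _ → a) φ ⇔ IsSquare p a
  where instance _ = prime⇒nonZero pr

DefinesMultiplication : (p : ℕ) → Prime p → PEFormula 3 → Set
DefinesMultiplication p pr μ =
  ∀ (x y w : Fin p) → Sat p (env x y w) μ ⇔ (toℕ w % p ≡ (toℕ x * toℕ y) % p)
  where
    instance _ = prime⇒nonZero pr
    env : Fin p → Fin p → Fin p → Fin 3 → Fin p
    env x y w F.zero = x
    env x y w (F.suc F.zero) = y
    env x y w (F.suc (F.suc F.zero)) = w

module Submission where

-- Part (i) is explicit: the disjunction x = 0² ∨ x = 1² ∨ ⋯ ∨ x = N² with N ≥ every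
-- prime of X defines the squares in each F_p, p ∈ X.
--
-- Part (ii) rests on two facts. First, every positive existential formula is a finite
-- disjunction of 'clauses' (conjunctions of linear equations under existential
-- quantifiers), and the set of solutions of a clause is closed under affine combinations
-- (1 − k)·x + k·y, because terms are sums of variables and constants. Hence in F_p a
-- clause satisfied by two distinct points is satisfied everywhere, since the affine line
-- through two distinct points of F_p is all of F_p. Second, for p > 2 not every element
-- of F_p is a square. If φ had K clauses and defined the squares in F_p with p > 2K + 2,
-- the K + 1 distinct squares 0², …, K² would by pigeonhole share a clause, which would
-- then hold everywhere, making every element a square. An infinite X contains such a p.
--
-- Part (iii) follows from (ii) for the set of all primes (infinite by Euclid's argument),
-- since a formula μ(x, y, w) for multiplication would give the formula ∃y. μ(y, y, x)
-- defining the squares.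

open import Defs
open import Level using (0ℓ)
open import Data.Nat
open import Data.Nat.Properties
open import Data.Nat.DivMod
open import Data.Nat.Divisibility
open import Data.Nat.Primality
open import Data.Nat.Coprimality using (prime⇒coprime; coprime-Bézout)
open import Data.Nat.GCD using (module Bézout)
open import Data.Nat.ListAction using (sum; product)
open import Data.Nat.Primality.Factorisation using (factorise)
open import Data.Nat.Solver using (module +-*-Solver)
open import Data.Fin as F using (Fin; toℕ; fromℕ<)
open import Data.Fin.Properties
  using (pigeonhole; toℕ-fromℕ<; toℕ<n; toℕ-injective; remQuot-combine; splitAt-↑ˡ; splitAt-↑ʳ)
  renaming (<⇒≢ to <⇒≢ᶠ)
open import Data.List using (List; []; _∷_)
open import Data.List.Relation.Unary.All using (All; _∷_)
open import Data.List.Relation.Unary.Any using (here; there)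
open import Data.List.Membership.Propositional using (_∈_)
open import Data.Product
open import Data.Product.Function.NonDependent.Propositional using (_×-⇔_)
open import Data.Product.Function.Dependent.Propositional using (congˡ)
open import Data.Sum using (inj₁; inj₂; [_,_]′)
open import Data.Sum.Function.Propositional using (_⊎-⇔_)
open import Function.Bundles using (_⇔_; Equivalence; mk⇔)
open import Function.Related.Propositional using (equivalence)
import Function.Properties.Equivalence as ⇔
open import Relation.Nullary
open import Data.Empty using (⊥)
open import Relation.Binary.Bundles using (Setoid)
open import Relation.Binary.PropositionalEquality
import Relation.Binary.Reasoning.Setoid as SetoidReasoning
open +-*-Solver using (solve; _:=_; _:+_; _:*_; con)

module Congruence (p : ℕ) .{{_ : NonZero p}} where

  -- a ≋ b: a and b leave the same remainder. A record, so that a and b can be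
  -- inferred from a proof.
  infix 4 _≋_
  record _≋_ (a b : ℕ) : Set where
    constructor congruent
    field remainders : a % p ≡ b % p
  open _≋_ public

  ≋-setoid : Setoid 0ℓ 0ℓ
  ≋-setoid = record
    { _≈_ = _≋_
    ; isEquivalence = record
      { refl  = congruent refl
      ; sym   = λ (congruent e) → congruent (sym e)
      ; trans = λ (congruent e) (congruent f) → congruent (trans e f)
      }
    }

  module ≋-Reasoning = SetoidReasoning ≋-setoid
  open Setoid ≋-setoid public using () renaming (refl to ≋-refl; sym to ≋-sym; trans to ≋-trans)

  ≋-reflexive : ∀ {a b} → a ≡ b → a ≋ b
  ≋-reflexive a≡b = congruent (cong (_% p) a≡b)

  +-cong : ∀ {a b c d} → a ≋ b → c ≋ d → a + c ≋ b + d
  +-cong {a} {b} {c} {d} (congruent a≋b) (congruent c≋d) = congruent (begin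
    (a + c) % p           ≡⟨ %-distribˡ-+ a c p ⟩
    (a % p + c % p) % p   ≡⟨ cong₂ (λ x y → (x + y) % p) a≋b c≋d ⟩
    (b % p + d % p) % p   ≡⟨ %-distribˡ-+ b d p ⟨
    (b + d) % p           ∎)
    where open ≡-Reasoning

  *-cong : ∀ {a b c d} → a ≋ b → c ≋ d → a * c ≋ b * d
  *-cong {a} {b} {c} {d} (congruent a≋b) (congruent c≋d) = congruent (begin
    (a * c) % p           ≡⟨ %-distribˡ-* a c p ⟩
    (a % p * (c % p)) % p ≡⟨ cong₂ (λ x y → (x * y) % p) a≋b c≋d ⟩
    (b % p * (d % p)) % p ≡⟨ %-distribˡ-* b d p ⟨
    (b * d) % p           ∎)
    where open ≡-Reasoning

  +-congˡ : ∀ a {b c} → b ≋ c → a + b ≋ a + c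
  +-congˡ a = +-cong (≋-refl {a})

  *-congˡ : ∀ a {b c} → b ≋ c → a * b ≋ a * c
  *-congˡ a = *-cong (≋-refl {a})

  +-multiple : ∀ a k → a + k * p ≋ a
  +-multiple a k = congruent ([m+kn]%n≡m%n a k p)

  ≋-canonical : ∀ {a b} → a < p → b < p → a ≋ b → a ≡ b
  ≋-canonical a<p b<p (congruent a≋b) = trans (sym (m<n⇒m%n≡m a<p)) (trans a≋b (m<n⇒m%n≡m b<p))

  ≋0⇒∣ : ∀ {a} → a ≋ 0 → p ∣ a
  ≋0⇒∣ {a} (congruent a≋0) = m%n≡0⇒n∣m a p (trans a≋0 (m<n⇒m%n≡m (>-nonZero⁻¹ p)))

  ∣-below⇒≡0 : ∀ {a} → p ∣ a → a < p → a ≡ 0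
  ∣-below⇒≡0 {zero}  _   _   = refl
  ∣-below⇒≡0 {suc a} p∣a a<p = contradiction p∣a (>⇒∤ a<p)

  residue : ℕ → Fin p
  residue a = fromℕ< (m%n<n a p)

  residue-≋ : ∀ a → toℕ (residue a) ≋ a
  residue-≋ a = congruent (trans (cong (_% p) (toℕ-fromℕ< (m%n<n a p))) (m%n%n≡m%n a p))

  square-of : ∀ b {a} → toℕ a ≋ b * b → IsSquare p a
  square-of b {a} a≋b² = residue b , remainders (begin
    toℕ (residue b) * toℕ (residue b)  ≈⟨ *-cong (residue-≋ b) (residue-≋ b) ⟩
    b * b                              ≈⟨ a≋b² ⟨
    toℕ a                              ∎)
    where open ≋-Reasoning

-- Disjunctive normal form. A positive existential formula φ is equivalent to a
-- disjunction of 'clauses φ' clauses; Clause p ρ φ c says the c-th one holds under ρ.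
-- Each clause is a conjunction of equations under existential quantifiers.
clauses : ∀ {n} → PEFormula n → ℕ
clauses (s ≐ t)  = 1
clauses (φ ∧′ ψ) = clauses φ * clauses ψ
clauses (φ ∨′ ψ) = clauses φ + clauses ψ
clauses (∃′ φ)   = clauses φ

Clause : (p : ℕ) → .{{NonZero p}} → ∀ {n} → (Fin n → Fin p) → (φ : PEFormula n) →
         Fin (clauses φ) → Set
Clause p ρ (s ≐ t)  c = Sat p ρ (s ≐ t)
Clause p ρ (φ ∧′ ψ) c = Clause p ρ φ (proj₁ (F.remQuot {clauses φ} (clauses ψ) c))
                      × Clause p ρ ψ (proj₂ (F.remQuot {clauses φ} (clauses ψ) c))
Clause p ρ (φ ∨′ ψ) c = [ Clause p ρ φ , Clause p ρ ψ ]′ (F.splitAt (clauses φ) c)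
Clause p ρ (∃′ φ)   c = Σ (Fin p) λ b → Clause p (extend b ρ) φ c

sat⇒clause : ∀ {p} .{{_ : NonZero p}} {n} (ρ : Fin n → Fin p) φ →
             Sat p ρ φ → Σ (Fin (clauses φ)) (Clause p ρ φ)
sat⇒clause ρ (s ≐ t) s≐t = F.zero , s≐t
sat⇒clause {p} ρ (φ ∧′ ψ) (sφ , sψ)
  with c₁ , h₁ ← sat⇒clause ρ φ sφ | c₂ , h₂ ← sat⇒clause ρ ψ sψ
  = F.combine c₁ c₂
  , subst (λ r → Clause p ρ φ (proj₁ r) × Clause p ρ ψ (proj₂ r))
          (sym (remQuot-combine c₁ c₂)) (h₁ , h₂)
sat⇒clause {p} ρ (φ ∨′ ψ) (inj₁ sφ) with c , h ← sat⇒clause ρ φ sφ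
  = c F.↑ˡ clauses ψ
  , subst [ Clause p ρ φ , Clause p ρ ψ ]′ (sym (splitAt-↑ˡ (clauses φ) c (clauses ψ))) h
sat⇒clause {p} ρ (φ ∨′ ψ) (inj₂ sψ) with c , h ← sat⇒clause ρ ψ sψ
  = clauses φ F.↑ʳ c
  , subst [ Clause p ρ φ , Clause p ρ ψ ]′ (sym (splitAt-↑ʳ (clauses φ) (clauses ψ) c)) h
sat⇒clause ρ (∃′ φ) (b , s) with c , h ← sat⇒clause (extend b ρ) φ s = c , b , h

clause⇒sat : ∀ {p} .{{_ : NonZero p}} {n} (ρ : Fin n → Fin p) φ c →
             Clause p ρ φ c → Sat p ρ φ
clause⇒sat ρ (s ≐ t)  c h        = h
clause⇒sat ρ (φ ∧′ ψ) c (h₁ , h₂) = clause⇒sat ρ φ _ h₁ , clause⇒sat ρ ψ _ h₂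
clause⇒sat ρ (φ ∨′ ψ) c h with F.splitAt (clauses φ) c
... | inj₁ c₁ = inj₁ (clause⇒sat ρ φ c₁ h)
... | inj₂ c₂ = inj₂ (clause⇒sat ρ ψ c₂ h)
clause⇒sat ρ (∃′ φ)   c (b , h)  = b , clause⇒sat (extend b ρ) φ c h

-- Arithmetic and affine geometry of ℤ/p for p = suc q, without primality. The number
-- q represents −1, so affine combinations (1 − k)·x + k·y need no subtraction.
module Residues (q : ℕ) where

  open Congruence (suc q)
  open ≋-Reasoning

  minus-one : ∀ a → a + q * a ≋ 0
  minus-one a = begin
    a + q * a       ≡⟨ solve 2 (λ a q → a :+ q :* a := con 0 :+ a :* (con 1 :+ q)) refl a q ⟩
    0 + a * suc q   ≈⟨ +-multiple 0 a ⟩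
    0               ∎

  +-cancelʳ : ∀ {a b} c → a + c ≋ b + c → a ≋ b
  +-cancelʳ {a} {b} c a+c≋b+c = begin
    a                 ≈⟨ +-multiple a c ⟨
    a + c * suc q     ≡⟨ shift a ⟩
    (a + c) + q * c   ≈⟨ +-cong a+c≋b+c ≋-refl ⟩
    (b + c) + q * c   ≡⟨ shift b ⟨
    b + c * suc q     ≈⟨ +-multiple b c ⟩
    b                 ∎
    where
    shift : ∀ x → x + c * suc q ≡ (x + c) + q * c
    shift x = solve 3 (λ x c q → x :+ c :* (con 1 :+ q) := (x :+ c) :+ q :* c) refl x c q

  -- (c + t)² − c² = t · (2c + t), so (c + t)² ≋ c² makes p divide t · (2c + t).
  ∣-difference-of-squares : ∀ c t → (c + t) * (c + t) ≋ c * c → suc q ∣ t * (c + (c + t))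
  ∣-difference-of-squares c t e = ≋0⇒∣ (+-cancelʳ (c * c) (begin
    t * (c + (c + t)) + c * c  ≡⟨ solve 2 (λ t c → t :* (c :+ (c :+ t)) :+ c :* c
                                        := (c :+ t) :* (c :+ t)) refl t c ⟩
    (c + t) * (c + t)          ≈⟨ e ⟩
    c * c                      ∎))

  -- The point with parameter k on the line through x (k = 0) and y (k = 1).
  along : ℕ → ℕ → ℕ → ℕ
  along k x y = (1 + q * k) * x + k * y

  along-cong : ∀ k {x x′ y y′} → x ≋ x′ → y ≋ y′ → along k x y ≋ along k x′ y′
  along-cong k x≋x′ y≋y′ = +-cong (*-congˡ (1 + q * k) x≋x′) (*-congˡ k y≋y′)

  -- Affine combinations fix the constant 1, as the coefficients 1 − k and k sum to 1.
  along-one : ∀ k → along k 1 1 ≋ 1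
  along-one k = begin
    along k 1 1    ≡⟨ solve 2 (λ k q → (con 1 :+ q :* k) :* con 1 :+ k :* con 1
                                     := con 1 :+ k :* (con 1 :+ q)) refl k q ⟩
    1 + k * suc q  ≈⟨ +-multiple 1 k ⟩
    1              ∎

  along-+ : ∀ k a b c d → along k (a + c) (b + d) ≡ along k a b + along k c d
  along-+ k a b c d = solve 6 (λ k q a b c d →
      (con 1 :+ q :* k) :* (a :+ c) :+ k :* (b :+ d)
    := ((con 1 :+ q :* k) :* a :+ k :* b) :+ ((con 1 :+ q :* k) :* c :+ k :* d))
    refl k q a b c d

  OnLine : ∀ {n} → ℕ → (ρ ρ₀ ρ₁ : Fin n → Fin (suc q)) → Set
  OnLine k ρ ρ₀ ρ₁ = ∀ i → toℕ (ρ i) ≋ along k (toℕ (ρ₀ i)) (toℕ (ρ₁ i))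

  -- Terms are affine maps: their values commute with affine combinations.
  eval-along : ∀ {n} k {ρ ρ₀ ρ₁ : Fin n → Fin (suc q)} → OnLine k ρ ρ₀ ρ₁ →
               ∀ t → eval ρ t ≋ along k (eval ρ₀ t) (eval ρ₁ t)
  eval-along k on (var i) = on i
  eval-along k on 𝟘       = ≋-reflexive (solve 2 (λ k q → con 0
                              := (con 1 :+ q :* k) :* con 0 :+ k :* con 0) refl k q)
  eval-along k on 𝟙       = ≋-sym (along-one k)
  eval-along k {ρ} {ρ₀} {ρ₁} on (s ⊕ t) = begin
    eval ρ s + eval ρ t
      ≈⟨ +-cong (eval-along k on s) (eval-along k on t) ⟩
    along k (eval ρ₀ s) (eval ρ₁ s) + along k (eval ρ₀ t) (eval ρ₁ t)
      ≡⟨ along-+ k (eval ρ₀ s) (eval ρ₁ s) (eval ρ₀ t) (eval ρ₁ t) ⟨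
    along k (eval ρ₀ s + eval ρ₀ t) (eval ρ₁ s + eval ρ₁ t) ∎

  clause-along : ∀ {n} k {ρ ρ₀ ρ₁ : Fin n → Fin (suc q)} → OnLine k ρ ρ₀ ρ₁ →
                 ∀ φ c → Clause (suc q) ρ₀ φ c → Clause (suc q) ρ₁ φ c → Clause (suc q) ρ φ c
  clause-along k {ρ} {ρ₀} {ρ₁} on (s ≐ t) c s₀ s₁ = remainders (begin
    eval ρ s                          ≈⟨ eval-along k on s ⟩
    along k (eval ρ₀ s) (eval ρ₁ s)   ≈⟨ along-cong k (congruent s₀) (congruent s₁) ⟩
    along k (eval ρ₀ t) (eval ρ₁ t)   ≈⟨ eval-along k on t ⟨
    eval ρ t                          ∎)
  clause-along k on (φ ∧′ ψ) c (h₀ , g₀) (h₁ , g₁) =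
    clause-along k on φ _ h₀ h₁ , clause-along k on ψ _ g₀ g₁
  clause-along k on (φ ∨′ ψ) c h₀ h₁ with F.splitAt (clauses φ) c
  ... | inj₁ c₁ = clause-along k on φ c₁ h₀ h₁
  ... | inj₂ c₂ = clause-along k on ψ c₂ h₀ h₁
  clause-along k {ρ} {ρ₀} {ρ₁} on (∃′ φ) c (b₀ , h₀) (b₁ , h₁) =
    b , clause-along k on′ φ c h₀ h₁
    where
    b : Fin (suc q)
    b = residue (along k (toℕ b₀) (toℕ b₁))
    on′ : OnLine k (extend b ρ) (extend b₀ ρ₀) (extend b₁ ρ₁)
    on′ F.zero    = residue-≋ (along k (toℕ b₀) (toℕ b₁))
    on′ (F.suc i) = on i

  q²≋1 : q * q ≋ 1
  q²≋1 = begin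
    q * q              ≈⟨ +-multiple (q * q) 1 ⟨
    q * q + 1 * suc q  ≡⟨ solve 1 (λ q → q :* q :+ con 1 :* (con 1 :+ q)
                                     := con 1 :+ q :* (con 1 :+ q)) refl q ⟩
    1 + q * suc q      ≈⟨ +-multiple 1 q ⟩
    1                  ∎

  root-below : 1 < q → ∀ {a} → IsSquare (suc q) a → Σ (Fin q) λ c → toℕ c * toℕ c ≋ toℕ a
  root-below 1<q {a} (b , b²≡a) with toℕ b <? q
  ... | yes b<q = fromℕ< b<q , subst (λ x → x * x ≋ toℕ a) (sym (toℕ-fromℕ< b<q)) (congruent b²≡a)
  ... | no  b≮q = fromℕ< 1<q , (begin
        toℕ (fromℕ< 1<q) * toℕ (fromℕ< 1<q) ≡⟨ cong (λ x → x * x) (toℕ-fromℕ< 1<q) ⟩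
        1                                   ≈⟨ q²≋1 ⟨
        q * q                               ≡⟨ cong (λ x → x * x) b≡q ⟨
        toℕ b * toℕ b                       ≈⟨ congruent b²≡a ⟩
        toℕ a                               ∎)
    where
    b≡q : toℕ b ≡ q
    b≡q = ≤-antisym (≤-pred (toℕ<n b)) (≮⇒≥ b≮q)

  -- For p > 2 not every element of F_p is a square: the p elements cannot have
  -- pairwise distinct square roots among the q = p − 1 numbers below q.
  not-all-squares : 1 < q → ¬ (∀ a → IsSquare (suc q) a)
  not-all-squares 1<q all-squares
    with pigeonhole (n<1+n q) (λ a → proj₁ (root-below 1<q (all-squares a)))
  ... | i , j , i<j , same-root = <⇒≢ᶠ i<j (toℕ-injective (≋-canonical (toℕ<n i) (toℕ<n j) (begin
        toℕ i                          ≈⟨ proj₂ (root i) ⟨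
        square (proj₁ (root i))        ≡⟨ cong square same-root ⟩
        square (proj₁ (root j))        ≈⟨ proj₂ (root j) ⟩
        toℕ j                          ∎)))
    where
    root : ∀ a → Σ (Fin q) λ c → toℕ c * toℕ c ≋ toℕ a
    root a = root-below 1<q (all-squares a)
    square : Fin q → ℕ
    square c = toℕ c * toℕ c

module PrimeField (q : ℕ) (pr : Prime (suc q)) where

  open Congruence (suc q)
  open Residues q
  open ≋-Reasoning

  -- Write b = c + t; by Euclid's lemma p divides t or 2c + t, both below p.
  square-injective-≤ : ∀ {b c} → c ≤ b → b + c < suc q → b * b ≋ c * c → b ≡ c
  square-injective-≤ {c = c} c≤b b+c<p e with t , refl ← m≤n⇒∃[o]m+o≡n c≤b
    with euclidsLemma t (c + (c + t)) pr (∣-difference-of-squares c t e)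
  ... | inj₁ p∣t = trans (cong (c +_) (∣-below⇒≡0 p∣t t<p)) (+-identityʳ c)
    where
    t<p : t < suc q
    t<p = ≤-<-trans (m≤n+m t c) (≤-<-trans (m≤m+n (c + t) c) b+c<p)
  ... | inj₂ p∣2c+t = trans (m+n≡0⇒n≡0 c 2c+t≡0) (sym (m+n≡0⇒m≡0 c 2c+t≡0))
    where
    2c+t≡0 : c + (c + t) ≡ 0
    2c+t≡0 = ∣-below⇒≡0 p∣2c+t (subst (_< suc q) (+-comm (c + t) c) b+c<p)

  square-injective : ∀ {b c} → b + c < suc q → b * b ≋ c * c → b ≡ c
  square-injective {b} {c} b+c<p e with ≤-total c b
  ... | inj₁ c≤b = square-injective-≤ c≤b b+c<p e
  ... | inj₂ b≤c = sym (square-injective-≤ b≤c (subst (_< suc q) (+-comm b c) b+c<p) (≋-sym e))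

  residue-square-injective : ∀ {b c} → b + c < suc q → residue (b * b) ≡ residue (c * c) → b ≡ c
  residue-square-injective {b} {c} b+c<p same = square-injective b+c<p (begin
    b * b                ≈⟨ residue-≋ (b * b) ⟨
    toℕ (residue (b * b)) ≡⟨ cong toℕ same ⟩
    toℕ (residue (c * c)) ≈⟨ residue-≋ (c * c) ⟩
    c * c                ∎)

  inverse-below : ∀ r → 0 < r → r < suc q → Σ ℕ λ z → z * r ≋ 1
  inverse-below (suc r) _ r<p with coprime-Bézout (prime⇒coprime pr r<p)
  ... | Bézout.-+ x y 1+xp≡yr = y , (begin
    y * suc r      ≡⟨ 1+xp≡yr ⟨
    1 + x * suc q  ≈⟨ +-multiple 1 x ⟩
    1              ∎)
  ... | Bézout.+- x y 1+yr≡xp = q * y , (begin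
    q * y * suc r                  ≈⟨ +-multiple (q * y * suc r) x ⟨
    q * y * suc r + x * suc q      ≡⟨ cong (q * y * suc r +_) 1+yr≡xp ⟨
    q * y * suc r + (1 + y * suc r) ≡⟨ solve 3 (λ q y r → q :* y :* r :+ (con 1 :+ y :* r)
                                          := con 1 :+ (y :* r) :* (con 1 :+ q)) refl q y (suc r) ⟩
    1 + y * suc r * suc q          ≈⟨ +-multiple 1 (y * suc r) ⟩
    1                              ∎)

  -- Opaque: only the existence of the inverse matters, and unfolding the Bézout
  -- computation on open terms is prohibitively expensive for the type checker.
  opaque
    inverse : ∀ {a} → ¬ a ≋ 0 → Σ ℕ λ z → z * a ≋ 1
    inverse {a} a≉0 = map₂ (λ {z} z*r≋1 → ≋-trans (*-congˡ z a≋r) z*r≋1)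
                            (inverse-below (a % suc q) 0<r (m%n<n a (suc q)))
      where
      a≋r : a ≋ a % suc q
      a≋r = ≋-sym (congruent (m%n%n≡m%n a (suc q)))
      0<r : 0 < a % suc q
      0<r = n≢0⇒n>0 (λ r≡0 → a≉0 (congruent r≡0))

  difference≉0 : ∀ {u v : Fin (suc q)} → u ≢ v → ¬ toℕ v + q * toℕ u ≋ 0
  difference≉0 {u} {v} u≢v d≋0 = u≢v (toℕ-injective (≋-canonical (toℕ<n u) (toℕ<n v) (begin
    x                     ≡⟨ +-identityʳ x ⟨
    x + 0                 ≈⟨ +-congˡ x d≋0 ⟨
    x + (y + q * x)       ≡⟨ solve 3 (λ q x y → x :+ (y :+ q :* x) := y :+ (x :+ q :* x)) refl q x y ⟩
    y + (x + q * x)       ≈⟨ +-congˡ y (minus-one x) ⟩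
    y + 0                 ≡⟨ +-identityʳ y ⟩
    y                     ∎)))
    where
    x y : ℕ
    x = toℕ u
    y = toℕ v

  -- Two distinct points u, v of F_p span it: every w is an affine combination of them,
  -- namely u + k·(v − u) with k = (w − u)/(v − u).
  line : ∀ {u v : Fin (suc q)} → u ≢ v →
         ∀ (w : Fin (suc q)) → Σ ℕ λ k → along k (toℕ u) (toℕ v) ≋ toℕ w
  line {u} {v} u≢v w with inverse (difference≉0 u≢v)
  ... | z , z*d≋1 = z * e , (begin
    along (z * e) x y           ≡⟨ solve 5 (λ q z e x y → (con 1 :+ q :* (z :* e)) :* x :+ (z :* e) :* y
                                         := x :+ e :* (z :* (y :+ q :* x))) refl q z e x y ⟩
    x + e * (z * (y + q * x))   ≈⟨ +-congˡ x (*-congˡ e z*d≋1) ⟩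
    x + e * 1                   ≡⟨ solve 3 (λ q x w → x :+ (w :+ q :* x) :* con 1
                                         := w :+ (x :+ q :* x)) refl q x (toℕ w) ⟩
    toℕ w + (x + q * x)         ≈⟨ +-congˡ (toℕ w) (minus-one x) ⟩
    toℕ w + 0                   ≡⟨ +-identityʳ (toℕ w) ⟩
    toℕ w                       ∎)
    where
    x y e : ℕ
    x = toℕ u
    y = toℕ v
    e = toℕ w + q * x

  clause-everywhere : ∀ (φ : PEFormula 1) c {u v : Fin (suc q)} → u ≢ v →
    Clause (suc q) (λ _ → u) φ c → Clause (suc q) (λ _ → v) φ c →
    ∀ w → Clause (suc q) (λ _ → w) φ c
  clause-everywhere φ c {u} {v} u≢v at-u at-v w =
    clause-along k (λ _ → ≋-sym on-line) φ c at-u at-v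
    where
    k : ℕ
    k = proj₁ (line u≢v w)
    on-line : along k (toℕ u) (toℕ v) ≋ toℕ w
    on-line = proj₂ (line u≢v w)

  -- A formula with K clauses does not define the squares of F_p once p ≥ 2K + 3:
  -- two of the K + 1 distinct squares 0², …, K² satisfy a common clause.
  squares-not-definable : ∀ φ → 3 + (clauses φ + clauses φ) ≤ suc q → ¬ DefinesSquares (suc q) pr φ
  squares-not-definable φ bound defines = shared-clause (pigeonhole (n<1+n K) clause-of)
    where
    K : ℕ
    K = clauses φ
    square : Fin (suc K) → Fin (suc q)
    square i = residue (toℕ i * toℕ i)
    satisfied : ∀ i → Σ (Fin K) (Clause (suc q) (λ _ → square i) φ)
    satisfied i = sat⇒clause _ φ (Equivalence.from (defines (square i))
                                   (square-of (toℕ i) (residue-≋ (toℕ i * toℕ i))))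
    clause-of : Fin (suc K) → Fin K
    clause-of i = proj₁ (satisfied i)
    distinct : ∀ {i j} → i F.< j → square i ≢ square j
    distinct {i} {j} i<j same = <⇒≢ᶠ i<j (toℕ-injective (residue-square-injective small same))
      where
      small : toℕ i + toℕ j < suc q
      small = ≤-<-trans (+-mono-≤ (≤-pred (toℕ<n i)) (≤-pred (toℕ<n j)))
                        (≤-trans (m≤n+m (suc (K + K)) 2) bound)
    shared-clause :
      (Σ[ i ∈ Fin (suc K) ] Σ[ j ∈ Fin (suc K) ] i F.< j × clause-of i ≡ clause-of j) → ⊥
    shared-clause (i , j , i<j , same-clause) = not-all-squares 1<q λ w →
      Equivalence.to (defines w) (clause⇒sat _ φ _ (clause-everywhere φ (clause-of i) (distinct i<j)
        (proj₂ (satisfied i)) (subst (Clause (suc q) _ φ) (sym same-clause) (proj₂ (satisfied j))) w))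
      where
      1<q : 1 < q
      1<q = ≤-pred (≤-trans (m≤m+n 3 (K + K)) bound)

no-definition-on-infinite-sets : (X : ℕ → Set) → (∀ p → X p → Prime p) →
  (∀ n → Σ ℕ λ p → n ≤ p × X p) →
  ¬ (Σ (PEFormula 1) λ φ → (p : ℕ) → X p → (pr : Prime p) → DefinesSquares p pr φ)
no-definition-on-infinite-sets X primes unbounded (φ , defines)
  with unbounded (3 + (clauses φ + clauses φ))
... | suc q , large , q+1∈X =
  PrimeField.squares-not-definable q pr φ large (defines (suc q) q+1∈X pr)
  where
  pr : Prime (suc q)
  pr = primes (suc q) q+1∈X

numeral : ∀ {n} → ℕ → Term n
numeral zero    = 𝟘
numeral (suc k) = 𝟙 ⊕ numeral k

eval-numeral : ∀ {n p} (ρ : Fin n → Fin p) k → eval ρ (numeral k) ≡ k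
eval-numeral ρ zero    = refl
eval-numeral ρ (suc k) = cong suc (eval-numeral ρ k)

is-square-of : ℕ → PEFormula 1
is-square-of b = var F.zero ≐ numeral (b * b)

is-square-upto : ℕ → PEFormula 1
is-square-upto zero    = is-square-of 0
is-square-upto (suc k) = is-square-upto k ∨′ is-square-of (suc k)

module SmallSquares (p : ℕ) .{{_ : NonZero p}} where

  open Congruence p

  is-square-of⇔ : ∀ b {a} → Sat p (λ _ → a) (is-square-of b) ⇔ toℕ a ≋ b * b
  is-square-of⇔ b {a} = mk⇔
    (λ s → congruent (trans s (cong (_% p) (eval-numeral (λ _ → a) (b * b)))))
    (λ (congruent e) → trans e (cong (_% p) (sym (eval-numeral (λ _ → a) (b * b)))))

  square-upto⇒square : ∀ k {a} → Sat p (λ _ → a) (is-square-upto k) → IsSquare p a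
  square-upto⇒square zero    s        = square-of 0 (Equivalence.to (is-square-of⇔ 0) s)
  square-upto⇒square (suc k) (inj₁ s) = square-upto⇒square k s
  square-upto⇒square (suc k) (inj₂ s) = square-of (suc k) (Equivalence.to (is-square-of⇔ (suc k)) s)

  square-of⇒square-upto : ∀ {k b a} → b ≤ k →
    Sat p (λ _ → a) (is-square-of b) → Sat p (λ _ → a) (is-square-upto k)
  square-of⇒square-upto {zero}  z≤n s = s
  square-of⇒square-upto {suc k} b≤k s with m≤n⇒m<n∨m≡n b≤k
  ... | inj₁ b<k  = inj₁ (square-of⇒square-upto (≤-pred b<k) s)
  ... | inj₂ refl = inj₂ s

  -- A square has a root b < p, so is-square-upto k is complete in F_p once k ≥ p − 1.
  square⇒square-upto : ∀ k {a} → p ≤ suc k → IsSquare p a → Sat p (λ _ → a) (is-square-upto k)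
  square⇒square-upto k p≤k+1 (b , b²≡a) = square-of⇒square-upto
    (≤-pred (≤-trans (toℕ<n b) p≤k+1))
    (Equivalence.from (is-square-of⇔ (toℕ b)) (congruent (sym b²≡a)))

∈⇒≤sum : ∀ {p X} → p ∈ X → p ≤ sum X
∈⇒≤sum (here refl)               = m≤m+n _ _
∈⇒≤sum {X = x ∷ X} (there p∈X)  = ≤-trans (∈⇒≤sum p∈X) (m≤n+m (sum X) x)

squares-definable-on-finite-sets : (X : List ℕ) →
  Σ (PEFormula 1) λ φ → (p : ℕ) → p ∈ X → (pr : Prime p) → DefinesSquares p pr φ
squares-definable-on-finite-sets X = is-square-upto (sum X) , defines
  where
  defines : (p : ℕ) → p ∈ X → (pr : Prime p) → DefinesSquares p pr (is-square-upto (sum X))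
  defines p p∈X pr a = mk⇔ (square-upto⇒square (sum X))
                           (square⇒square-upto (sum X) (m≤n⇒m≤1+n (∈⇒≤sum p∈X)))
    where open SmallSquares p {{prime⇒nonZero pr}}

∣-factorial : ∀ {m n} → .{{NonZero m}} → m ≤ n → m ∣ n !
∣-factorial {suc m} m≤n = ∣-trans (m∣m*n (m !)) (m≤n⇒m!∣n! m≤n)

-- Euclid: any prime factor of n! + 1 exceeds n, so there are arbitrarily large primes.
primes-unbounded : ∀ n → Σ ℕ λ p → n ≤ p × Prime p
primes-unbounded n with factorise (suc (n !))
... | record { factors = [] ; isFactorisation = n!+1≡1 } =
  contradiction (sym (suc-injective n!+1≡1)) (<⇒≢ (1≤n! n))
... | record { factors = p ∷ ps ; isFactorisation = n!+1≡p*ps ; factorsPrime = pr ∷ _ }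
  with n <? p
...   | yes n<p = p , <⇒≤ n<p , pr
...   | no  n≮p = contradiction (subst Prime (∣1⇒≡1 p∣1) pr) ¬prime[1]
  where
  p∣n!+1 : p ∣ n ! + 1
  p∣n!+1 = subst (p ∣_) (trans (sym n!+1≡p*ps) (+-comm 1 (n !))) (m∣m*n (product ps))
  p∣1 : p ∣ 1
  p∣1 = ∣m+n∣m⇒∣n p∣n!+1 (∣-factorial {{prime⇒nonZero pr}} (≮⇒≥ n≮p))

lift : ∀ {n m} → (Fin n → Fin m) → Fin (suc n) → Fin (suc m)
lift σ F.zero    = F.zero
lift σ (F.suc i) = F.suc (σ i)

rename-term : ∀ {n m} → (Fin n → Fin m) → Term n → Term m
rename-term σ (var i) = var (σ i)
rename-term σ 𝟘       = 𝟘
rename-term σ 𝟙       = 𝟙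
rename-term σ (s ⊕ t) = rename-term σ s ⊕ rename-term σ t

rename : ∀ {n m} → (Fin n → Fin m) → PEFormula n → PEFormula m
rename σ (s ≐ t)  = rename-term σ s ≐ rename-term σ t
rename σ (φ ∧′ ψ) = rename σ φ ∧′ rename σ ψ
rename σ (φ ∨′ ψ) = rename σ φ ∨′ rename σ ψ
rename σ (∃′ φ)   = ∃′ (rename (lift σ) φ)

Agrees : ∀ {n m p} → (Fin n → Fin m) → (Fin m → Fin p) → (Fin n → Fin p) → Set
Agrees σ ρ τ = ∀ i → τ i ≡ ρ (σ i)

rename-eval : ∀ {n m p} (σ : Fin n → Fin m) {ρ : Fin m → Fin p} {τ} → Agrees σ ρ τ →
              ∀ t → eval ρ (rename-term σ t) ≡ eval τ t
rename-eval σ agrees (var i) = cong toℕ (sym (agrees i))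
rename-eval σ agrees 𝟘       = refl
rename-eval σ agrees 𝟙       = refl
rename-eval σ agrees (s ⊕ t) = cong₂ _+_ (rename-eval σ agrees s) (rename-eval σ agrees t)

rename-sat : ∀ {n m p} .{{_ : NonZero p}} (σ : Fin n → Fin m) {ρ : Fin m → Fin p} {τ} →
             Agrees σ ρ τ → ∀ φ → Sat p ρ (rename σ φ) ⇔ Sat p τ φ
rename-sat {p = p} σ agrees (s ≐ t) = mk⇔
  (subst₂ (λ x y → x % p ≡ y % p) (rename-eval σ agrees s) (rename-eval σ agrees t))
  (subst₂ (λ x y → x % p ≡ y % p) (sym (rename-eval σ agrees s)) (sym (rename-eval σ agrees t)))
rename-sat σ agrees (φ ∧′ ψ) = rename-sat σ agrees φ ×-⇔ rename-sat σ agrees ψ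
rename-sat σ agrees (φ ∨′ ψ) = rename-sat σ agrees φ ⊎-⇔ rename-sat σ agrees ψ
rename-sat σ {ρ} {τ} agrees (∃′ φ) =
  congˡ {k = equivalence} λ {b} → rename-sat (lift σ) (lifted b) φ
  where
  lifted : ∀ b → Agrees (lift σ) (extend b ρ) (extend b τ)
  lifted b F.zero    = refl
  lifted b (F.suc i) = agrees i

-- From μ(x, y, w) defining multiplication, ∃y. μ(y, y, x) defines the squares.
diagonal : Fin 3 → Fin 2
diagonal F.zero                 = F.zero
diagonal (F.suc F.zero)         = F.zero
diagonal (F.suc (F.suc F.zero)) = F.suc F.zero

square-formula : PEFormula 3 → PEFormula 1
square-formula μ = ∃′ (rename diagonal μ)

multiplication⇒squares : ∀ p (pr : Prime p) μ →
  DefinesMultiplication p pr μ → DefinesSquares p pr (square-formula μ)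
multiplication⇒squares p pr μ defines a =
  ⇔.trans (congˡ {k = equivalence} λ {b} →
             ⇔.trans (rename-sat diagonal (agrees b) μ) (defines b b a))
          (mk⇔ (map₂ sym) (map₂ sym))
  where
  instance _ = prime⇒nonZero pr
  -- The right-hand assignment is the one DefinesMultiplication uses for (b, b, a).
  agrees : ∀ b → Agrees diagonal (extend b (λ _ → a)) _
  agrees b F.zero                 = refl
  agrees b (F.suc F.zero)         = refl
  agrees b (F.suc (F.suc F.zero)) = refl

proposition1p5 :
    ((X : List ℕ) → X ≢ [] → (prX : All Prime X) →
      Σ (PEFormula 1) λ φ → (p : ℕ) → p ∈ X → (pr : Prime p) → DefinesSquares p pr φ)
    × ((X : ℕ → Set) → (∀ p → X p → Prime p) → (∀ n → Σ ℕ λ p → n ≤ p × X p) →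
      ¬ (Σ (PEFormula 1) λ φ → (p : ℕ) → X p → (pr : Prime p) → DefinesSquares p pr φ))
    × ¬ (Σ (PEFormula 3) λ μ → (p : ℕ) → (pr : Prime p) → DefinesMultiplication p pr μ)
proposition1p5 =
  (λ X _ _ → squares-definable-on-finite-sets X) ,
  no-definition-on-infinite-sets ,
  no-multiplication
  where
  no-multiplication :
    ¬ (Σ (PEFormula 3) λ μ → (p : ℕ) → (pr : Prime p) → DefinesMultiplication p pr μ)
  no-multiplication (μ , defines) =
    no-definition-on-infinite-sets Prime (λ _ pr → pr) primes-unbounded
      (square-formula μ , λ p _ pr → multiplication⇒squares p pr μ (defines p pr))
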